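{- Let \(G\) be a finite simple connected graph with \(\Delta(G)\le 4\) that is not the octahedron. Let \(a,b,c,x\) be normal vertices of \(G\) and \(T\) an inner triangle of \(G\) such that in \(K^2(G)\) the following are edges: \(a^*b^*\), \(a^*c^*\), \(b^*c^*\), \(b^*x^*\), \(c^*x^*\), \(a^*Q_T\), \(b^*Q_T\). Then \(a^*x^*\) is an edge of \(K^2(G)\) or \(c^*Q_T\) is an edge of \(K^2(G)\).
   Context: A clique is a maximal complete subgraph; \(K(G)\) is the intersection graph of the cliques of \(G\), \(K^2(G)=K(K(G))\). For \(v\in G\), the star \(v^*=\{q\in K(G): v\in q\}\); \(v\) is normal if \(v^*\) is a clique of \(K(G)\), i.e. a vertex of \(K^2(G)\). A triangle is a complete subgraph on three vertices; a triangle \(T\) is inner if it is a clique of \(G\) and for each edge \(e\) of \(T\) there is a triangle \(T'\ne T\) with \(T\cap T'=e\). For an inner triangle \(T\), \(Q_T=\{q\in K(G): |q\cap T|\ge 2\}\) (a vertex of \(K^2(G)\) for such \(G\)). The octahedron is \(K_{2,2,2}\). -}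

module Defs where

open import Data.Nat using (ℕ; _≤_; _/_)
open import Data.Bool using (Bool; true; false; T; not)
open import Data.Fin using (Fin; toℕ)
open import Data.Fin.Subset using (Subset; _∈_; _∉_; _∩_; _∪_; ⁅_⁆; ∣_∣)
open import Data.Vec using (tabulate)
open import Data.Product using (Σ; ∃; _×_; _,_)
open import Data.Empty using (⊥)
open import Relation.Nullary using (¬_)
open import Relation.Binary.PropositionalEquality using (_≡_; _≢_)
open import Relation.Nullary.Decidable using (⌊_⌋)
open import Data.Nat.Properties using () renaming (_≟_ to _≟ℕ_)
open import Function.Bundles using (_↔_; Inverse)

record Graph (n : ℕ) : Set where
  field
    adj    : Fin n → Fin n → Bool
    sym    : ∀ i j → adj i j ≡ adj j i
    irrefl : ∀ i → adj i i ≡ false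

module _ {n : ℕ} (G : Graph n) where
  open Graph G

  Adj : Fin n → Fin n → Set
  Adj i j = T (adj i j)

  data Walk : Fin n → Fin n → Set where
    here : ∀ {i} → Walk i i
    step : ∀ {i j k} → Adj i j → Walk j k → Walk i k

  Connected : Set
  Connected = ∀ i j → Walk i j

  N : Fin n → Subset n
  N v = tabulate (adj v)

  MaxDegreeAtMost4 : Set
  MaxDegreeAtMost4 = ∀ v → ∣ N v ∣ ≤ 4

  Complete : Subset n → Set
  Complete q = ∀ i j → i ∈ q → j ∈ q → i ≢ j → Adj i j

  IsClique : Subset n → Set
  IsClique q = Complete q × (∀ w → (∀ i → i ∈ q → i ≢ w → Adj i w) → w ∈ q)

  Meet : Subset n → Subset n → Set
  Meet q q' = ∃ λ i → i ∈ q × i ∈ q'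

  AdjK : Subset n → Subset n → Set
  AdjK q q' = IsClique q × IsClique q' × q ≢ q' × Meet q q'

  -- subsets of V(K(G)), given as predicates on Subset n
  SetK : Set₁
  SetK = Subset n → Set

  _≐_ : SetK → SetK → Set
  𝒬 ≐ 𝒬' = ∀ q → IsClique q → (𝒬 q → 𝒬' q) × (𝒬' q → 𝒬 q)

  -- cliques of K(G), i.e. the vertices of K²(G)
  IsCliqueK : SetK → Set
  IsCliqueK 𝒬 =
    (∀ q → 𝒬 q → IsClique q)
    × (∀ q q' → 𝒬 q → 𝒬 q' → q ≢ q' → AdjK q q')
    × (∀ q → IsClique q → (∀ q' → 𝒬 q' → q' ≢ q → AdjK q' q) → 𝒬 q)

  AdjK² : SetK → SetK → Set
  AdjK² 𝒬 𝒬' = IsCliqueK 𝒬 × IsCliqueK 𝒬' × ¬ (𝒬 ≐ 𝒬')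
                × (∃ λ q → IsClique q × 𝒬 q × 𝒬' q)

  star : Fin n → SetK
  star v q = IsClique q × v ∈ q

  Normal : Fin n → Set
  Normal v = IsCliqueK (star v)

  Triangle : Subset n → Set
  Triangle t = ∣ t ∣ ≡ 3 × Complete t

  InnerTriangle : Subset n → Set
  InnerTriangle t =
    Triangle t × IsClique t
    × (∀ u v → u ∈ t → v ∈ t → u ≢ v →
         ∃ λ t' → Triangle t' × t' ≢ t × (t ∩ t') ≡ (⁅ u ⁆ ∪ ⁅ v ⁆))

  Q : Subset n → SetK
  Q t q = IsClique q × 2 ≤ ∣ q ∩ t ∣

-- The octahedron K_{2,2,2} on Fin 6: parts {0,1}, {2,3}, {4,5}

octAdj : Fin 6 → Fin 6 → Bool
octAdj i j = not ⌊ (toℕ i / 2) ≟ℕ (toℕ j / 2) ⌋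

IsOctahedron : ∀ {n} → Graph n → Set
IsOctahedron {n} G =
  Σ (Fin n ↔ Fin 6) λ f →
    ∀ i j → Graph.adj G i j ≡ octAdj (Inverse.to f i) (Inverse.to f j)

module Submission where

-- As c is normal, c* and Q_T are vertices of K²(G), and they differ: otherwise c ∈ T,
-- and the clique through the other two vertices u, v of T and an apex w of uv lies in Q_T, so it
-- contains c and w would be adjacent to all of T.  It remains to find a clique through c meeting T
-- twice, which exists once c is in T or adjacent to T: by Δ ≤ 4 the neighbours of m ∈ T are the
-- other two vertices of T and the apices of its two edges, so an outside neighbour of m sees two
-- vertices of T.  Finally c is adjacent to T.  If not, a and b lie outside T, a is adjacent to two
-- vertices p, r of T but not to the third s, and b to two of p, r, s.  If b ≁ s then p has the five
-- neighbours r, s, a, b and the apex of ps.  If b ~ s, b ~ u for some u ∈ {p, r}, and the neighbours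
-- of a are exactly u, the other vertex u′ of {p, r}, b and c; hence every clique through a meets the
-- clique through u, s, b, which by normality of a then contains a, although a ≁ s.

open import Defs
open import Data.Nat using (ℕ; zero; suc; _≤_; _<_; z≤n; s≤s; _+_)
open import Data.Nat.Properties
  using (≤-refl; ≤-reflexive; ≤-trans; ≤-<-trans; <⇒≱; n≤1+n; m≤m+n; +-suc; +-monoʳ-≤)
open import Data.Bool using (T)
open import Data.Bool.Properties using (T-≡)
open import Data.Fin using (Fin; zero; suc; _≟_)
open import Data.Fin.Subset
  using (Subset; _∈_; _∉_; _⊆_; _∪_; _∩_; ⁅_⁆; _-_; ∣_∣; inside; outside)
  renaming (⊥ to ∅)
open import Data.Fin.Subset.Properties
  using (_∈?_; p─⊥≡p; ∣p∣≤n; ∣⊥∣≡0; p⊆q⇒∣p∣≤∣q∣; p⊂q⇒∣p∣<∣q∣; p─q⊆p; x∈p∧x≢y⇒x∈p-y;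
         x∈p⇒∣p-x∣<∣p∣; p⊆p∪q; q⊆p∪q; x∈p∪q⁻; x∈⁅x⁆; x∈⁅y⁆⇒x≡y; x∈p∩q⁺; x∈p∩q⁻)
open import Data.Fin.Properties using (any?; all?)
open import Data.Vec using (_∷_; here; there)
open import Data.Vec.Properties using (lookup⇒[]=; lookup∘tabulate)
open import Data.List using ([]; _∷_; length)
open import Data.List.Relation.Unary.All as All using (All; []; _∷_)
open import Data.List.Relation.Unary.All.Properties using (¬Any⇒All¬)
open import Data.List.Relation.Unary.Any using (here; there) renaming (any? to anyₗ?)
open import Data.List.Relation.Unary.AllPairs using ([]; _∷_)
open import Data.List.Relation.Unary.Unique.Propositional using (Unique)
open import Data.List.Membership.Propositional using () renaming (_∈_ to _∈ₗ_)
open import Data.Product using (∃; ∃₂; _×_; _,_; proj₁; proj₂)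
open import Data.Sum using (_⊎_; inj₁; inj₂)
open import Data.Empty using (⊥; ⊥-elim)
open import Function using (id; _∘_; case_of_)
open import Function.Bundles using (Equivalence)
open import Relation.Nullary using (¬_; Dec; yes; no; contradiction)
open import Relation.Nullary.Decidable using (¬?; _×-dec_; _→-dec_; T?)
open import Relation.Binary.PropositionalEquality using (_≡_; _≢_; refl; sym; trans; cong; subst; ≢-sym)

private
  variable
    n : ℕ

∣p∣≤1+∣p-x∣ : ∀ (p : Subset n) x → ∣ p ∣ ≤ suc ∣ p - x ∣
∣p∣≤1+∣p-x∣ (inside  ∷ p) zero    = s≤s (≤-reflexive (cong ∣_∣ (sym (p─⊥≡p p))))
∣p∣≤1+∣p-x∣ (outside ∷ p) zero    = ≤-trans (≤-reflexive (cong ∣_∣ (sym (p─⊥≡p p)))) (n≤1+n _)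
∣p∣≤1+∣p-x∣ (inside  ∷ p) (suc x) = s≤s (∣p∣≤1+∣p-x∣ p x)
∣p∣≤1+∣p-x∣ (outside ∷ p) (suc x) = ∣p∣≤1+∣p-x∣ p x

x∉p-x : ∀ (p : Subset n) x → x ∉ p - x
x∉p-x (_ ∷ p) zero    ()
x∉p-x (_ ∷ p) (suc x) (there x∈p-x) = x∉p-x p x x∈p-x

∈p-x⁻ : ∀ (p : Subset n) {x y} → y ∈ p - x → y ∈ p × y ≢ x
∈p-x⁻ p {x} y∈p-x = p─q⊆p p ⁅ x ⁆ y∈p-x , λ { refl → x∉p-x p x y∈p-x }

Unique⇒length≤∣p∣ : ∀ {p : Subset n} {xs} → Unique xs → All (_∈ p) xs → length xs ≤ ∣ p ∣
Unique⇒length≤∣p∣ []                  []             = z≤n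
Unique⇒length≤∣p∣ {p = p} {x ∷ xs} (x≢xs ∷ xs-unique) (x∈p ∷ xs⊆p) =
  ≤-trans (s≤s (Unique⇒length≤∣p∣ xs-unique xs⊆p-x)) (x∈p⇒∣p-x∣<∣p∣ x∈p)
  where
  xs⊆p-x : All (_∈ p - x) xs
  xs⊆p-x = All.zipWith
             (λ (x≢y , y∈p) → x∈p∧x≢y⇒x∈p-y y∈p (≢-sym x≢y)) (x≢xs , xs⊆p)

⊆xs⇒∣p∣≤length : ∀ (p : Subset n) xs → (∀ {y} → y ∈ p → y ∈ₗ xs) → ∣ p ∣ ≤ length xs
⊆xs⇒∣p∣≤length {n} p []       p⊆[] =
  ≤-trans (p⊆q⇒∣p∣≤∣q∣ {q = ∅} (λ y∈p → case p⊆[] y∈p of λ ())) (≤-reflexive (∣⊥∣≡0 n))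
⊆xs⇒∣p∣≤length p (x ∷ xs) p⊆xs = ≤-trans (∣p∣≤1+∣p-x∣ p x) (s≤s (⊆xs⇒∣p∣≤length (p - x) xs p-x⊆xs))
  where
  p-x⊆xs : ∀ {y} → y ∈ p - x → y ∈ₗ xs
  p-x⊆xs y∈p-x with ∈p-x⁻ p y∈p-x
  ... | y∈p , y≢x with p⊆xs y∈p
  ...   | here y≡x      = contradiction y≡x y≢x
  ...   | there y∈xs    = y∈xs

∃∈p-avoiding : ∀ (p : Subset n) xs → length xs < ∣ p ∣ → ∃ λ y → y ∈ p × All (y ≢_) xs
∃∈p-avoiding p xs xs<p with any? (λ y → y ∈? p ×-dec ¬? (anyₗ? (y ≟_) xs))
... | yes (y , y∈p , y∉xs) = y , y∈p , ¬Any⇒All¬ xs y∉xs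
... | no ∄y = contradiction (⊆xs⇒∣p∣≤length p xs p⊆xs) (<⇒≱ xs<p)
  where
  p⊆xs : ∀ {y} → y ∈ p → y ∈ₗ xs
  p⊆xs {y} y∈p with anyₗ? (y ≟_) xs
  ... | yes y∈xs = y∈xs
  ... | no  y∉xs = contradiction (y , y∈p , y∉xs) ∄y

∈p⇒∈ₗ-enumeration : ∀ {p : Subset n} {xs y} →
                     ∣ p ∣ ≤ length xs → Unique xs → All (_∈ p) xs → y ∈ p → y ∈ₗ xs
∈p⇒∈ₗ-enumeration {p = p} {xs} {y} p≤xs xs-unique xs⊆p y∈p with anyₗ? (y ≟_) xs
... | yes y∈xs = y∈xs
... | no  y∉xs = contradiction y∷xs≤p (<⇒≱ (s≤s p≤xs))
  where
  y∷xs≤p : suc (length xs) ≤ ∣ p ∣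
  y∷xs≤p = Unique⇒length≤∣p∣ (¬Any⇒All¬ xs y∉xs ∷ xs-unique) (y∈p ∷ xs⊆p)

two-distinct : ∀ (p : Subset n) → 2 ≤ ∣ p ∣ → ∃₂ λ x y → x ∈ p × y ∈ p × x ≢ y
two-distinct p 2≤p with ∃∈p-avoiding p [] (≤-trans (s≤s z≤n) 2≤p)
... | x , x∈p , [] with ∃∈p-avoiding p (x ∷ []) 2≤p
...   | y , y∈p , y≢x ∷ [] = x , y , x∈p , y∈p , ≢-sym y≢x

∈∪⁅⁆⁻ : ∀ (s : Subset n) {w i} → i ∈ s ∪ ⁅ w ⁆ → i ∈ s ⊎ i ≡ w
∈∪⁅⁆⁻ s {w} i∈ with x∈p∪q⁻ s ⁅ w ⁆ i∈
... | inj₁ i∈s   = inj₁ i∈s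
... | inj₂ i∈⁅w⁆ = inj₂ (x∈⁅y⁆⇒x≡y w i∈⁅w⁆)

∣s∣<∣s∪⁅w⁆∣ : ∀ (s : Subset n) {w} → w ∉ s → ∣ s ∣ < ∣ s ∪ ⁅ w ⁆ ∣
∣s∣<∣s∪⁅w⁆∣ s {w} w∉s = p⊂q⇒∣p∣<∣q∣ (p⊆p∪q ⁅ w ⁆ , w , q⊆p∪q s ⁅ w ⁆ (x∈⁅x⁆ w) , w∉s)

∈⇒≢∉ : ∀ {p : Subset n} {x y} → x ∈ p → y ∉ p → x ≢ y
∈⇒≢∉ x∈p y∉p refl = y∉p x∈p

module _ (G : Graph n) where

  Adj-sym : ∀ {i j} → Adj G i j → Adj G j i
  Adj-sym {i} {j} = subst T (Graph.sym G i j)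

  Adj⇒≢ : ∀ {i j} → Adj G i j → i ≢ j
  Adj⇒≢ {i} i~i refl = subst T (Graph.irrefl G i) i~i

  Adj? : ∀ i j → Dec (Adj G i j)
  Adj? i j = T? (Graph.adj G i j)

  Adj⇒∈N : ∀ {v y} → Adj G v y → y ∈ N G v
  Adj⇒∈N {v} {y} v~y =
    lookup⇒[]= y (N G v) (trans (lookup∘tabulate (Graph.adj G v) y) (Equivalence.to T-≡ v~y))

  Complete-⁅⁆ : ∀ x → Complete G ⁅ x ⁆
  Complete-⁅⁆ x i j i∈⁅x⁆ j∈⁅x⁆ i≢j =
    contradiction (trans (x∈⁅y⁆⇒x≡y x i∈⁅x⁆) (sym (x∈⁅y⁆⇒x≡y x j∈⁅x⁆))) i≢j

  Complete-∪⁅⁆ : ∀ {s w} → Complete G s → (∀ i → i ∈ s → i ≢ w → Adj G i w) → Complete G (s ∪ ⁅ w ⁆)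
  Complete-∪⁅⁆ {s} {w} s-complete s~w i j i∈ j∈ i≢j with ∈∪⁅⁆⁻ s i∈ | ∈∪⁅⁆⁻ s j∈
  ... | inj₁ i∈s  | inj₁ j∈s  = s-complete i j i∈s j∈s i≢j
  ... | inj₁ i∈s  | inj₂ refl = s~w i i∈s i≢j
  ... | inj₂ refl | inj₁ j∈s  = Adj-sym (s~w j j∈s (≢-sym i≢j))
  ... | inj₂ refl | inj₂ refl = contradiction refl i≢j

  Extends : Subset n → Fin n → Set
  Extends s w = w ∉ s × (∀ i → i ∈ s → i ≢ w → Adj G i w)

  extends? : ∀ s → Dec (∃ (Extends s))
  extends? s = any? λ w → ¬? (w ∈? s) ×-dec all? λ i → i ∈? s →-dec (¬? (i ≟ w) →-dec Adj? i w)

  Complete⇒⊆clique : ∀ s → Complete G s → ∃ λ q → IsClique G q × s ⊆ q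
  Complete⇒⊆clique s = extend n s (m≤m+n n ∣ s ∣)
    where
    extend : ∀ k s → n ≤ k + ∣ s ∣ → Complete G s → ∃ λ q → IsClique G q × s ⊆ q
    extend k s n≤k+s s-complete with extends? s
    ... | no ∄w = s , (s-complete , maximal) , id
      where
      maximal : ∀ w → (∀ i → i ∈ s → i ≢ w → Adj G i w) → w ∈ s
      maximal w s~w with w ∈? s
      ... | yes w∈s = w∈s
      ... | no  w∉s = contradiction (w , w∉s , s~w) ∄w
    extend zero s n≤s s-complete | yes (w , w∉s , _) =
      contradiction (∣p∣≤n (s ∪ ⁅ w ⁆)) (<⇒≱ (≤-<-trans n≤s (∣s∣<∣s∪⁅w⁆∣ s w∉s)))
    extend (suc k) s n≤1+k+s s-complete | yes (w , w∉s , s~w)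
      with extend k (s ∪ ⁅ w ⁆) n≤k+s∪w (Complete-∪⁅⁆ s-complete s~w)
      where
      n≤k+s∪w : n ≤ k + ∣ s ∪ ⁅ w ⁆ ∣
      n≤k+s∪w = ≤-trans n≤1+k+s
                  (≤-trans (≤-reflexive (sym (+-suc k ∣ s ∣))) (+-monoʳ-≤ k (∣s∣<∣s∪⁅w⁆∣ s w∉s)))
    ... | q , q-clique , s∪w⊆q = q , q-clique , s∪w⊆q ∘ p⊆p∪q ⁅ w ⁆

  triangle⊆clique : ∀ {x y z} → Adj G x y → Adj G x z → Adj G y z →
                    ∃ λ q → IsClique G q × x ∈ q × y ∈ q × z ∈ q
  triangle⊆clique {x} {y} {z} x~y x~z y~z with Complete⇒⊆clique ((⁅ x ⁆ ∪ ⁅ y ⁆) ∪ ⁅ z ⁆) xyz-complete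
    where
    xyz-complete : Complete G ((⁅ x ⁆ ∪ ⁅ y ⁆) ∪ ⁅ z ⁆)
    xyz-complete = Complete-∪⁅⁆ (Complete-∪⁅⁆ (Complete-⁅⁆ x) x~y′) xy~z
      where
      x~y′ : ∀ i → i ∈ ⁅ x ⁆ → i ≢ y → Adj G i y
      x~y′ i i∈⁅x⁆ _ rewrite x∈⁅y⁆⇒x≡y x i∈⁅x⁆ = x~y
      xy~z : ∀ i → i ∈ ⁅ x ⁆ ∪ ⁅ y ⁆ → i ≢ z → Adj G i z
      xy~z i i∈ _ with ∈∪⁅⁆⁻ ⁅ x ⁆ i∈
      ... | inj₁ i∈⁅x⁆ rewrite x∈⁅y⁆⇒x≡y x i∈⁅x⁆ = x~z
      ... | inj₂ refl = y~z
  ... | q , q-clique , xyz⊆q =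
    q , q-clique , xyz⊆q (p⊆p∪q ⁅ z ⁆ (p⊆p∪q ⁅ y ⁆ (x∈⁅x⁆ x)))
                 , xyz⊆q (p⊆p∪q ⁅ z ⁆ (q⊆p∪q ⁅ x ⁆ ⁅ y ⁆ (x∈⁅x⁆ y)))
                 , xyz⊆q (q⊆p∪q (⁅ x ⁆ ∪ ⁅ y ⁆) ⁅ z ⁆ (x∈⁅x⁆ z))

  Normal⇒∈-of-meeting-star : ∀ {a q} → Normal G a → IsClique G q →
                              (∀ q′ → IsClique G q′ → a ∈ q′ → Meet G q′ q) → a ∈ q
  Normal⇒∈-of-meeting-star {q = q} (_ , _ , maximal) q-clique meets =
    proj₂ (maximal q q-clique λ q′ (q′-clique , a∈q′) q′≢q →
      q′-clique , q-clique , q′≢q , meets q′ q′-clique a∈q′)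

  AdjK²-stars⇒Adj : ∀ {a b} → AdjK² G (star G a) (star G b) → Adj G a b
  AdjK²-stars⇒Adj {a} {b} (_ , _ , a*≉b* , q , (q-complete , _) , (_ , a∈q) , (_ , b∈q)) =
    q-complete a b a∈q b∈q a≢b
    where
    a≢b : a ≢ b
    a≢b refl = a*≉b* λ _ _ → id , id

  -- A clique through a avoiding u and b lies in {a, u′, c}; since c ≁ u′ it could be
  -- enlarged by b (if it contains c) or by u (if not).
  clique∋a-meets-u-or-b : ∀ {a u u′ b c q} →
    (∀ {i} → Adj G a i → i ∈ₗ (u ∷ u′ ∷ b ∷ c ∷ [])) →
    Adj G a u → Adj G a b → Adj G u u′ → Adj G b c → ¬ Adj G c u′ → u′ ≢ c →
    IsClique G q → a ∈ q → u ∈ q ⊎ b ∈ q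
  clique∋a-meets-u-or-b {a} {u} {u′} {b} {c} {q}
                        nbhd a~u a~b u~u′ b~c c≁u′ u′≢c (q-complete , q-maximal) a∈q =
    meets (u ∈? q) (b ∈? q) (c ∈? q)
    where
    joins : ∀ {w} → Adj G a w → (∀ {i} → i ∈ₗ (u ∷ u′ ∷ b ∷ c ∷ []) → i ∈ q → i ≢ w → Adj G i w) →
            ∀ i → i ∈ q → i ≢ w → Adj G i w
    joins a~w others i i∈q i≢w with i ≟ a
    ... | yes refl = a~w
    ... | no  i≢a  = others (nbhd (q-complete a i a∈q i∈q (≢-sym i≢a))) i∈q i≢w

    meets : Dec (u ∈ q) → Dec (b ∈ q) → Dec (c ∈ q) → u ∈ q ⊎ b ∈ q
    meets (yes u∈q) _         _         = inj₁ u∈q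
    meets (no  _)   (yes b∈q) _         = inj₂ b∈q
    meets (no  u∉q) (no  b∉q) (yes c∈q) = contradiction (q-maximal b (joins a~b b-joins)) b∉q
      where
      b-joins : ∀ {i} → i ∈ₗ (u ∷ u′ ∷ b ∷ c ∷ []) → i ∈ q → i ≢ b → Adj G i b
      b-joins (here refl)                         i∈q _   = contradiction i∈q u∉q
      b-joins (there (here refl))                 i∈q _   = contradiction (q-complete c u′ c∈q i∈q (≢-sym u′≢c)) c≁u′
      b-joins (there (there (here refl)))         _   i≢b = contradiction refl i≢b
      b-joins (there (there (there (here refl)))) _   _   = Adj-sym b~c
    meets (no  u∉q) (no  b∉q) (no  c∉q) = contradiction (q-maximal u (joins a~u u-joins)) u∉q
      where
      u-joins : ∀ {i} → i ∈ₗ (u ∷ u′ ∷ b ∷ c ∷ []) → i ∈ q → i ≢ u → Adj G i u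
      u-joins (here refl)                         _   i≢u = contradiction refl i≢u
      u-joins (there (here refl))                 _   _   = Adj-sym u~u′
      u-joins (there (there (here refl)))         i∈q _   = contradiction i∈q b∉q
      u-joins (there (there (there (here refl)))) i∈q _   = contradiction i∈q c∉q

  module _ (Δ≤4 : MaxDegreeAtMost4 G) where

    Δ≤4⇒length≤4 : ∀ {v xs} → Unique xs → All (Adj G v) xs → length xs ≤ 4
    Δ≤4⇒length≤4 {v} xs-unique v~xs =
      ≤-trans (Unique⇒length≤∣p∣ xs-unique (All.map Adj⇒∈N v~xs)) (Δ≤4 v)

    Δ≤4⇒∈ₗneighbours : ∀ {v xs y} → 4 ≤ length xs → Unique xs → All (Adj G v) xs → Adj G v y → y ∈ₗ xs
    Δ≤4⇒∈ₗneighbours {v} 4≤xs xs-unique v~xs v~y =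
      ∈p⇒∈ₗ-enumeration (≤-trans (Δ≤4 v) 4≤xs) xs-unique
        (All.map Adj⇒∈N v~xs) (Adj⇒∈N v~y)

module InnerTriangleLemmas (G : Graph n) (t : Subset n) (inner : InnerTriangle G t) where

  private
    ∣t∣≡3 : ∣ t ∣ ≡ 3
    ∣t∣≡3 = proj₁ (proj₁ inner)

    t-clique : IsClique G t
    t-clique = proj₁ (proj₂ inner)

    t-complete : Complete G t
    t-complete = proj₁ t-clique

  TwoNeighboursInT : Fin n → Set
  TwoNeighboursInT y = ∃₂ λ u v → u ∈ t × v ∈ t × u ≢ v × Adj G y u × Adj G y v

  record ThirdVertex (u v : Fin n) : Set where
    constructor third
    field
      s     : Fin n
      s∈t   : s ∈ t
      s≢u   : s ≢ u
      s≢v   : s ≢ v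
      t⊆uvs : ∀ {y} → y ∈ t → y ∈ₗ (u ∷ v ∷ s ∷ [])

    ¬Adj-all : ∀ {w} → Adj G w u → Adj G w v → ¬ Adj G w s
    ¬Adj-all {w} w~u w~v w~s = Adj⇒≢ G (w~t w∈t) refl
      where
      w~t : ∀ {i} → i ∈ t → Adj G w i
      w~t i∈t with t⊆uvs i∈t
      ... | here refl                 = w~u
      ... | there (here refl)         = w~v
      ... | there (there (here refl)) = w~s
      w∈t : w ∈ t
      w∈t = proj₂ t-clique w λ i i∈t _ → Adj-sym G (w~t i∈t)

    two-of-three : ∀ {y} → TwoNeighboursInT y →
                   (Adj G y u × Adj G y v) ⊎ (Adj G y u × Adj G y s) ⊎ (Adj G y v × Adj G y s)
    two-of-three (x , x′ , x∈t , x′∈t , x≢x′ , y~x , y~x′) with t⊆uvs x∈t | t⊆uvs x′∈t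
    ... | here refl                 | here refl                 = contradiction refl x≢x′
    ... | here refl                 | there (here refl)         = inj₁ (y~x , y~x′)
    ... | here refl                 | there (there (here refl)) = inj₂ (inj₁ (y~x , y~x′))
    ... | there (here refl)         | here refl                 = inj₁ (y~x′ , y~x)
    ... | there (here refl)         | there (here refl)         = contradiction refl x≢x′
    ... | there (here refl)         | there (there (here refl)) = inj₂ (inj₂ (y~x , y~x′))
    ... | there (there (here refl)) | here refl                 = inj₂ (inj₁ (y~x′ , y~x))
    ... | there (there (here refl)) | there (here refl)         = inj₂ (inj₂ (y~x′ , y~x))
    ... | there (there (here refl)) | there (there (here refl)) = contradiction refl x≢x′

  third-vertex : ∀ {u v} → u ∈ t → v ∈ t → u ≢ v → ThirdVertex u v
  third-vertex {u} {v} u∈t v∈t u≢v with ∃∈p-avoiding t (u ∷ v ∷ []) (≤-reflexive (sym ∣t∣≡3))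
  ... | s , s∈t , s≢u ∷ s≢v ∷ [] =
    third s s∈t s≢u s≢v
      (∈p⇒∈ₗ-enumeration (≤-reflexive ∣t∣≡3) ((u≢v ∷ ≢-sym s≢u ∷ []) ∷ (≢-sym s≢v ∷ []) ∷ [] ∷ [])
        (u∈t ∷ v∈t ∷ s∈t ∷ []))

  other-vertex : ∀ {u} → u ∈ t → ∃ λ v → v ∈ t × v ≢ u
  other-vertex {u} _ with ∃∈p-avoiding t (u ∷ []) (≤-trans (s≤s (s≤s z≤n)) (≤-reflexive (sym ∣t∣≡3)))
  ... | v , v∈t , v≢u ∷ [] = v , v∈t , v≢u

  apex : ∀ {u v} → u ∈ t → v ∈ t → u ≢ v → ∃ λ w → w ∉ t × Adj G w u × Adj G w v
  apex {u} {v} u∈t v∈t u≢v with proj₂ (proj₂ inner) u v u∈t v∈t u≢v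
  ... | t′ , (∣t′∣≡3 , t′-complete) , _ , t∩t′≡uv
    with ∃∈p-avoiding t′ (u ∷ v ∷ []) (≤-reflexive (sym ∣t′∣≡3))
  ... | w , w∈t′ , w≢u ∷ w≢v ∷ [] =
    w , w∉t , t′-complete w u w∈t′ (∈t′ (p⊆p∪q ⁅ v ⁆ (x∈⁅x⁆ u))) w≢u
            , t′-complete w v w∈t′ (∈t′ (q⊆p∪q ⁅ u ⁆ ⁅ v ⁆ (x∈⁅x⁆ v))) w≢v
    where
    ∈t′ : ∀ {x} → x ∈ ⁅ u ⁆ ∪ ⁅ v ⁆ → x ∈ t′
    ∈t′ x∈uv = proj₂ (x∈p∩q⁻ t t′ (subst (_ ∈_) (sym t∩t′≡uv) x∈uv))
    w∉t : w ∉ t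
    w∉t w∈t with ∈∪⁅⁆⁻ ⁅ u ⁆ (subst (w ∈_) t∩t′≡uv (x∈p∩q⁺ (w∈t , w∈t′)))
    ... | inj₁ w∈⁅u⁆ = w≢u (x∈⁅y⁆⇒x≡y u w∈⁅u⁆)
    ... | inj₂ w≡v   = w≢v w≡v

  2≤∣q∩t∣ : ∀ {q u v} → u ∈ q → v ∈ q → u ∈ t → v ∈ t → u ≢ v → 2 ≤ ∣ q ∩ t ∣
  2≤∣q∩t∣ u∈q v∈q u∈t v∈t u≢v =
    Unique⇒length≤∣p∣ ((u≢v ∷ []) ∷ [] ∷ []) (x∈p∩q⁺ (u∈q , u∈t) ∷ x∈p∩q⁺ (v∈q , v∈t) ∷ [])

  ∈Q⇒TwoNeighboursInT : ∀ {y q} → y ∉ t → Q G t q → y ∈ q → TwoNeighboursInT y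
  ∈Q⇒TwoNeighboursInT {q = q} y∉t ((q-complete , _) , q-meets-t-twice) y∈q
    with two-distinct (q ∩ t) q-meets-t-twice
  ... | u , v , u∈q∩t , v∈q∩t , u≢v with x∈p∩q⁻ q t u∈q∩t | x∈p∩q⁻ q t v∈q∩t
  ...   | u∈q , u∈t | v∈q , v∈t =
    u , v , u∈t , v∈t , u≢v , q-complete _ u y∈q u∈q (≢-sym (∈⇒≢∉ u∈t y∉t))
                            , q-complete _ v y∈q v∈q (≢-sym (∈⇒≢∉ v∈t y∉t))

  TwoNeighboursInT⇒∈Q : ∀ {y} → TwoNeighboursInT y → ∃ λ q → Q G t q × y ∈ q
  TwoNeighboursInT⇒∈Q (u , v , u∈t , v∈t , u≢v , y~u , y~v)
    with triangle⊆clique G (t-complete u v u∈t v∈t u≢v) (Adj-sym G y~u) (Adj-sym G y~v)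
  ... | q , q-clique , u∈q , v∈q , y∈q = q , (q-clique , 2≤∣q∩t∣ u∈q v∈q u∈t v∈t u≢v) , y∈q

  t∈Q : Q G t t
  t∈Q with two-distinct t (≤-trans (s≤s (s≤s z≤n)) (≤-reflexive (sym ∣t∣≡3)))
  ... | x , y , x∈t , y∈t , x≢y = t-clique , 2≤∣q∩t∣ x∈t y∈t x∈t y∈t x≢y

  star≉Q : ∀ c → ¬ (_≐_ G (star G c) (Q G t))
  star≉Q c c*≐Q with proj₂ (proj₂ (c*≐Q t t-clique) t∈Q)
  ... | c∈t with other-vertex c∈t
  ... | u , u∈t , u≢c with third-vertex c∈t u∈t (≢-sym u≢c)
  ... | c,u,v@(third v v∈t _ v≢u _) with apex u∈t v∈t (≢-sym v≢u)
  ... | w , w∉t , w~u , w~v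
    with triangle⊆clique G (t-complete u v u∈t v∈t (≢-sym v≢u)) (Adj-sym G w~u) (Adj-sym G w~v)
  ... | q , q-clique , u∈q , v∈q , w∈q = ThirdVertex.¬Adj-all c,u,v w~c w~u w~v
    where
    c∈q : c ∈ q
    c∈q = proj₂ (proj₂ (c*≐Q q q-clique) (q-clique , 2≤∣q∩t∣ u∈q v∈q u∈t v∈t (≢-sym v≢u)))
    w~c : Adj G w c
    w~c = proj₁ q-clique w c w∈q c∈q (≢-sym (∈⇒≢∉ c∈t w∉t))

  ∈Q⇒AdjK²-star-Q : ∀ {c} → Normal G c → IsCliqueK G (Q G t) → (∃ λ q → Q G t q × c ∈ q) →
                    AdjK² G (star G c) (Q G t)
  ∈Q⇒AdjK²-star-Q {c} c-normal Q-cliqueK (q , q∈Q@(q-clique , _) , c∈q) =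
    c-normal , Q-cliqueK , star≉Q c , q , q-clique , (q-clique , c∈q) , q∈Q

  module _ (Δ≤4 : MaxDegreeAtMost4 G) where

    Adj-t⇒TwoNeighboursInT : ∀ {y m} → y ∉ t → m ∈ t → Adj G y m → TwoNeighboursInT y
    Adj-t⇒TwoNeighboursInT {y} {m} y∉t m∈t y~m with other-vertex m∈t
    ... | m₁ , m₁∈t , m₁≢m with third-vertex m∈t m₁∈t (≢-sym m₁≢m)
    ... | m,m₁,m₂@(third m₂ m₂∈t m₂≢m m₂≢m₁ _)
      with apex m∈t m₁∈t (≢-sym m₁≢m) | apex m∈t m₂∈t (≢-sym m₂≢m)
    ... | w₁ , w₁∉t , w₁~m , w₁~m₁ | w₂ , w₂∉t , w₂~m , w₂~m₂
      with Δ≤4⇒∈ₗneighbours G Δ≤4 ≤-refl m-nbhd-unique m~nbhd (Adj-sym G y~m)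
      where
      w₁≢w₂ : w₁ ≢ w₂
      w₁≢w₂ refl = ThirdVertex.¬Adj-all m,m₁,m₂ w₁~m w₁~m₁ w₂~m₂
      m-nbhd-unique : Unique (m₁ ∷ m₂ ∷ w₁ ∷ w₂ ∷ [])
      m-nbhd-unique = (≢-sym m₂≢m₁ ∷ ∈⇒≢∉ m₁∈t w₁∉t ∷ ∈⇒≢∉ m₁∈t w₂∉t ∷ [])
                    ∷ (∈⇒≢∉ m₂∈t w₁∉t ∷ ∈⇒≢∉ m₂∈t w₂∉t ∷ []) ∷ (w₁≢w₂ ∷ []) ∷ [] ∷ []
      m~nbhd : All (Adj G m) (m₁ ∷ m₂ ∷ w₁ ∷ w₂ ∷ [])
      m~nbhd = t-complete m m₁ m∈t m₁∈t (≢-sym m₁≢m) ∷ t-complete m m₂ m∈t m₂∈t (≢-sym m₂≢m)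
             ∷ Adj-sym G w₁~m ∷ Adj-sym G w₂~m ∷ []
    ... | here refl                         = contradiction m₁∈t y∉t
    ... | there (here refl)                 = contradiction m₂∈t y∉t
    ... | there (there (here refl))         = m , m₁ , m∈t , m₁∈t , ≢-sym m₁≢m , w₁~m , w₁~m₁
    ... | there (there (there (here refl))) = m , m₂ , m∈t , m₂∈t , ≢-sym m₂≢m , w₂~m , w₂~m₂

    Adj-t⇒∈Q : ∀ {y} → (∃ λ m → m ∈ t × Adj G y m) → ∃ λ q → Q G t q × y ∈ q
    Adj-t⇒∈Q {y} (m , m∈t , y~m) with y ∈? t
    ... | yes y∈t = t , t∈Q , y∈t
    ... | no  y∉t = TwoNeighboursInT⇒∈Q (Adj-t⇒TwoNeighboursInT y∉t m∈t y~m)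

    outer-neighbours-missing-s-≡ : ∀ {p s a b} → p ∈ t → s ∈ t → p ≢ s → a ∉ t → b ∉ t →
                                   Adj G a p → Adj G b p → ¬ Adj G a s → ¬ Adj G b s → a ≡ b
    outer-neighbours-missing-s-≡ {p} {s} {a} {b} p∈t s∈t p≢s a∉t b∉t a~p b~p a≁s b≁s with a ≟ b
    ... | yes a≡b = a≡b
    ... | no  a≢b with third-vertex p∈t s∈t p≢s | apex p∈t s∈t p≢s
    ...   | third r r∈t r≢p r≢s _ | w , w∉t , w~p , w~s =
      contradiction (Δ≤4⇒length≤4 G Δ≤4 p-nbhd-unique p~nbhd) λ { (s≤s (s≤s (s≤s (s≤s ())))) }
      where
      p-nbhd-unique : Unique (r ∷ s ∷ a ∷ b ∷ w ∷ [])
      p-nbhd-unique = (r≢s ∷ ∈⇒≢∉ r∈t a∉t ∷ ∈⇒≢∉ r∈t b∉t ∷ ∈⇒≢∉ r∈t w∉t ∷ [])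
                    ∷ (∈⇒≢∉ s∈t a∉t ∷ ∈⇒≢∉ s∈t b∉t ∷ ∈⇒≢∉ s∈t w∉t ∷ [])
                    ∷ (a≢b ∷ (λ { refl → a≁s w~s }) ∷ [])
                    ∷ ((λ { refl → b≁s w~s }) ∷ []) ∷ [] ∷ []
      p~nbhd : All (Adj G p) (r ∷ s ∷ a ∷ b ∷ w ∷ [])
      p~nbhd = t-complete p r p∈t r∈t (≢-sym r≢p) ∷ t-complete p s p∈t s∈t p≢s
             ∷ Adj-sym G a~p ∷ Adj-sym G b~p ∷ Adj-sym G w~p ∷ []

    Normal-⊥ : ∀ {a b c u u′ s} → Normal G a → Adj G a b → Adj G a c → Adj G b c →
               (∀ {m} → m ∈ t → ¬ Adj G c m) → u ∈ t → u′ ∈ t → s ∈ t → u ≢ u′ →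
               Adj G a u → Adj G a u′ → ¬ Adj G a s → Adj G b u → Adj G b s → ⊥
    Normal-⊥ {a} {b} {c} {u} {u′} {s} a-normal a~b a~c b~c c≁t u∈t u′∈t s∈t u≢u′ a~u a~u′ a≁s b~u b~s
      with triangle⊆clique G (t-complete u s u∈t s∈t u≢s) (Adj-sym G b~u) (Adj-sym G b~s)
      where
      u≢s : u ≢ s
      u≢s refl = a≁s a~u
    ... | q , q-clique , u∈q , s∈q , b∈q =
      a≁s (proj₁ q-clique a s a∈q s∈q (≢-sym (∈⇒≢∉ s∈t a∉t)))
      where
      a∉t : a ∉ t
      a∉t a∈t = c≁t a∈t (Adj-sym G a~c)
      b∉t : b ∉ t
      b∉t b∈t = c≁t b∈t (Adj-sym G b~c)
      c∉t : c ∉ t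
      c∉t c∈t with other-vertex c∈t
      ... | v , v∈t , v≢c = c≁t v∈t (t-complete c v c∈t v∈t (≢-sym v≢c))
      a-nbhd : ∀ {i} → Adj G a i → i ∈ₗ (u ∷ u′ ∷ b ∷ c ∷ [])
      a-nbhd = Δ≤4⇒∈ₗneighbours G Δ≤4 ≤-refl
        ((u≢u′ ∷ ∈⇒≢∉ u∈t b∉t ∷ ∈⇒≢∉ u∈t c∉t ∷ []) ∷ (∈⇒≢∉ u′∈t b∉t ∷ ∈⇒≢∉ u′∈t c∉t ∷ [])
          ∷ (Adj⇒≢ G b~c ∷ []) ∷ [] ∷ [])
        (a~u ∷ a~u′ ∷ a~b ∷ a~c ∷ [])
      a∈q : a ∈ q
      a∈q = Normal⇒∈-of-meeting-star G a-normal q-clique λ q′ q′-clique a∈q′ →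
        case clique∋a-meets-u-or-b G a-nbhd a~u a~b (t-complete u u′ u∈t u′∈t u≢u′) b~c
               (c≁t u′∈t) (∈⇒≢∉ u′∈t c∉t) q′-clique a∈q′ of λ where
          (inj₁ u∈q′) → u , u∈q′ , u∈q
          (inj₂ b∈q′) → b , b∈q′ , b∈q

    triangle-on-Q-cliques⇒Adj-t : ∀ {a b c qa qb} → Normal G a → Adj G a b → Adj G a c → Adj G b c →
                                  Q G t qa → a ∈ qa → Q G t qb → b ∈ qb → ∃ λ m → m ∈ t × Adj G c m
    triangle-on-Q-cliques⇒Adj-t {a} {b} {c} a-normal a~b a~c b~c qa∈Q a∈qa qb∈Q b∈qb
      with any? (λ m → m ∈? t ×-dec Adj? G c m)
    ... | yes c~t = c~t
    ... | no  ∄m  =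
      ⊥-elim (cases (∈Q⇒TwoNeighboursInT a∉t qa∈Q a∈qa) (∈Q⇒TwoNeighboursInT b∉t qb∈Q b∈qb))
      where
      c≁t : ∀ {m} → m ∈ t → ¬ Adj G c m
      c≁t m∈t c~m = ∄m (_ , m∈t , c~m)
      a∉t : a ∉ t
      a∉t a∈t = c≁t a∈t (Adj-sym G a~c)
      b∉t : b ∉ t
      b∉t b∈t = c≁t b∈t (Adj-sym G b~c)

      cases : TwoNeighboursInT a → TwoNeighboursInT b → ⊥
      cases (p , r , p∈t , r∈t , p≢r , a~p , a~r) b~t = b-cases (two-of-three b~t)
        where
        open ThirdVertex (third-vertex p∈t r∈t p≢r) using (s; s∈t; s≢u; ¬Adj-all; two-of-three)
        a≁s : ¬ Adj G a s
        a≁s = ¬Adj-all a~p a~r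
        b-cases : (Adj G b p × Adj G b r) ⊎ (Adj G b p × Adj G b s) ⊎ (Adj G b r × Adj G b s) → ⊥
        b-cases (inj₁ (b~p , b~r)) with Adj? G b s
        ... | yes b~s = Normal-⊥ a-normal a~b a~c b~c c≁t p∈t r∈t s∈t p≢r a~p a~r a≁s b~p b~s
        ... | no  b≁s =
          Adj⇒≢ G a~b (outer-neighbours-missing-s-≡ p∈t s∈t (≢-sym s≢u) a∉t b∉t a~p b~p a≁s b≁s)
        b-cases (inj₂ (inj₁ (b~p , b~s))) = Normal-⊥ a-normal a~b a~c b~c c≁t p∈t r∈t s∈t p≢r a~p a~r a≁s b~p b~s
        b-cases (inj₂ (inj₂ (b~r , b~s))) =
          Normal-⊥ a-normal a~b a~c b~c c≁t r∈t p∈t s∈t (≢-sym p≢r) a~r a~p a≁s b~r b~s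

mainTheorem12 : ∀ {n} (G : Graph n) →
    Connected G → MaxDegreeAtMost4 G → ¬ IsOctahedron G →
    (a b c x : Fin n) (t : Subset n) →
    Normal G a → Normal G b → Normal G c → Normal G x →
    InnerTriangle G t →
    AdjK² G (star G a) (star G b) →
    AdjK² G (star G a) (star G c) →
    AdjK² G (star G b) (star G c) →
    AdjK² G (star G b) (star G x) →
    AdjK² G (star G c) (star G x) →
    AdjK² G (star G a) (Q G t) →
    AdjK² G (star G b) (Q G t) →
    AdjK² G (star G a) (star G x) ⊎ AdjK² G (star G c) (Q G t)
mainTheorem12 G _ Δ≤4 _ a b c _ t a-normal _ c-normal _ inner a*b* a*c* b*c* _ _
  (_ , Q-cliqueK , _ , qa , _ , (_ , a∈qa) , qa∈Q) (_ , _ , _ , qb , _ , (_ , b∈qb) , qb∈Q) =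
  inj₂ (∈Q⇒AdjK²-star-Q c-normal Q-cliqueK (Adj-t⇒∈Q Δ≤4 c~t))
  where
  open InnerTriangleLemmas G t inner
  c~t : ∃ λ m → m ∈ t × Adj G c m
  c~t = triangle-on-Q-cliques⇒Adj-t Δ≤4 a-normal (AdjK²-stars⇒Adj G a*b*) (AdjK²-stars⇒Adj G a*c*)
          (AdjK²-stars⇒Adj G b*c*) qa∈Q a∈qa qb∈Q b∈qb
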